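{- For positive integers $k,l$, \[ k+l+\binom{k+l}{k+1}\le n_1(k,l), \] where $n_1(k,l)$ is the maximum of $\left|\bigcup_{i=1}^m(A_i\cup B_i)\right|$ over all $(k,l)$-skew cross intersecting systems $(A_1,B_1),\dots,(A_m,B_m)$.
   Context: A system of set pairs $(A_1,B_1),\dots,(A_m,B_m)$ is $(k,l)$-skew cross intersecting if $|A_i|\le k$ and $|B_i|\le l$ for all $i$, $A_i\cap B_i=\emptyset$ for all $1\le i\le m$, and $A_i\cap B_j\neq\emptyset$ for all $1\le i<j\le m$. -}

module Defs where

open import Data.Nat using (ℕ; _≤_)
open import Data.Fin using (Fin; _<_)
open import Data.Fin.Subset using (Subset; _∩_; _∪_; ∣_∣; Empty; Nonempty; ⋃)
open import Data.List using (map; allFin)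
open import Data.Product using (_×_)

record SkewCrossIntersecting (k l N m : ℕ) (A B : Fin m → Subset N) : Set where
  field
    sizeA    : ∀ i → ∣ A i ∣ ≤ k
    sizeB    : ∀ i → ∣ B i ∣ ≤ l
    disjoint : ∀ i → Empty (A i ∩ B i)
    cross    : ∀ i j → i < j → Nonempty (A i ∩ B j)

unionPairs : ∀ {N m} → (Fin m → Subset N) → (Fin m → Subset N) → Subset N
unionPairs {m = m} A B = ⋃ (map (λ i → A i ∪ B i) (allFin m))

-- A single pair (∅, [l]) resp.
-- ([k], ∅) handles k = 0 resp. l = 0.  For k, l ≥ 1 we take a system S for
-- (k-1, l) and a system T for (k, l-1) on disjoint ground sets, add one fresh
-- point x, put x into every A of S and into every B of T, and list the pairs of
-- S before those of T.  Every pair of S then meets every later pair of T in x,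
-- and the union grows to 1 + |⋃S| + |⋃T|.
module Submission where

open import Defs
open import Data.Bool using (Bool; _∧_; _∨_)
open import Data.Nat using (ℕ; zero; suc; _+_; _≤_; s≤s)
open import Data.Nat.Combinatorics using (_C_; nCk+nC[k+1]≡[n+1]C[k+1]; nC1≡n; k>n⇒nCk≡0)
open import Data.Nat.Properties using (+-identityʳ; +-assoc; +-suc; +-mono-≤; +-monoʳ-≤; m≤n+m; n<1+n; ≤-reflexive; ≤-trans; module ≤-Reasoning)
open import Data.Fin using (Fin; zero; suc; _<_)
open import Data.Fin.Subset using (Subset; ∣_∣; _∩_; _∪_; ⊥; ⊤; ⋃; inside; outside; Empty; Nonempty)
open import Data.Fin.Subset.Properties using (∪-identityʳ; ∪-identityˡ; ∪-assoc; ∩-zeroˡ; ∩-zeroʳ; ∣⊥∣≡0; ∣⊤∣≡n; ∉⊥; drop-∷-Empty)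
open import Data.Product using (Σ; _×_; _,_; proj₁; proj₂)
open import Data.Vec using ([]; _∷_; _++_; here; there)
open import Data.Vec.Properties using (zipWith-++)
open import Data.List using (List; []; _∷_; map; length; lookup; tabulate; allFin) renaming (_++_ to _++ₗ_)
open import Data.List.Properties using (map-tabulate; tabulate-lookup)
open import Data.List.Membership.Propositional.Properties using (∈-lookup)
open import Data.List.Relation.Unary.All as All using (All; []; _∷_)
import Data.List.Relation.Unary.All.Properties as All
open import Data.List.Relation.Unary.AllPairs as AllPairs using (AllPairs; []; _∷_)
import Data.List.Relation.Unary.AllPairs.Properties as AllPairs
open import Relation.Binary.PropositionalEquality using (_≡_; refl; sym; trans; cong; cong₂; subst; module ≡-Reasoning)

private
  variable
    a b k l n : ℕ

∣++∣ : (x : Subset a) (y : Subset b) → ∣ x ++ y ∣ ≡ ∣ x ∣ + ∣ y ∣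
∣++∣ []            y = refl
∣++∣ (inside ∷ x)  y = cong suc (∣++∣ x y)
∣++∣ (outside ∷ x) y = ∣++∣ x y

∣++⊥∣ : (x : Subset a) → ∣ x ++ ⊥ {b} ∣ ≡ ∣ x ∣
∣++⊥∣ {b = b} x = trans (∣++∣ x ⊥) (trans (cong (∣ x ∣ +_) (∣⊥∣≡0 b)) (+-identityʳ ∣ x ∣))

∣⊥++∣ : (y : Subset b) → ∣ ⊥ {a} ++ y ∣ ≡ ∣ y ∣
∣⊥++∣ {a = a} y = trans (∣++∣ (⊥ {a}) y) (cong (_+ ∣ y ∣) (∣⊥∣≡0 a))

Empty-⊥ : Empty (⊥ {n})
Empty-⊥ (_ , x∈⊥) = ∉⊥ x∈⊥

Empty-outside : {x : Subset n} → Empty x → Empty (outside ∷ x)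
Empty-outside e (zero  , ())
Empty-outside e (suc i , there i∈x) = e (i , i∈x)

Empty-++ : (x : Subset a) {y : Subset b} → Empty x → Empty y → Empty (x ++ y)
Empty-++ []      ex ey = ey
Empty-++ (_ ∷ x) ex ey (zero  , here)       = ex (zero , here)
Empty-++ (_ ∷ x) ex ey (suc i , there i∈xy) = Empty-++ x (drop-∷-Empty ex) ey (i , i∈xy)

Nonempty-∷ : ∀ z {x : Subset n} → Nonempty x → Nonempty (z ∷ x)
Nonempty-∷ z (i , i∈x) = suc i , there i∈x

Nonempty-++ˡ : (x : Subset a) {y : Subset b} → Nonempty x → Nonempty (x ++ y)
Nonempty-++ˡ (_ ∷ x) (zero  , here)      = zero , here
Nonempty-++ˡ (z ∷ x) (suc i , there i∈x) = Nonempty-∷ z (Nonempty-++ˡ x (i , i∈x))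

Nonempty-++ʳ : (x : Subset a) {y : Subset b} → Nonempty y → Nonempty (x ++ y)
Nonempty-++ʳ []      ne = ne
Nonempty-++ʳ (z ∷ x) ne = Nonempty-∷ z (Nonempty-++ʳ x ne)

-- The merged ground set Fin (1 + a + b) consists of a fresh point followed by
-- a block of size a and a block of size b; `glue z x y` is the subset which
-- contains the fresh point iff z, and meets the blocks in x and y.
glue : Bool → Subset a → Subset b → Subset (suc (a + b))
glue z x y = z ∷ (x ++ y)

glue-∩ : ∀ z z' (x x' : Subset a) (y y' : Subset b) →
         glue z x y ∩ glue z' x' y' ≡ glue (z ∧ z') (x ∩ x') (y ∩ y')
glue-∩ z z' x x' y y' = cong ((z ∧ z') ∷_) (zipWith-++ _∧_ x y x' y')

glue-∪ : ∀ z z' (x x' : Subset a) (y y' : Subset b) →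
         glue z x y ∪ glue z' x' y' ≡ glue (z ∨ z') (x ∪ x') (y ∪ y')
glue-∪ z z' x x' y y' = cong ((z ∨ z') ∷_) (zipWith-++ _∨_ x y x' y')

glue-∪-left : ∀ z z' (x x' : Subset a) →
              glue z x (⊥ {b}) ∪ glue z' x' ⊥ ≡ glue (z ∨ z') (x ∪ x') ⊥
glue-∪-left z z' x x' = trans (glue-∪ z z' x x' ⊥ ⊥) (cong (glue (z ∨ z') (x ∪ x')) (∪-identityʳ ⊥))

glue-∪-right : ∀ z z' (y y' : Subset b) →
               glue z (⊥ {a}) y ∪ glue z' ⊥ y' ≡ glue (z ∨ z') ⊥ (y ∪ y')
glue-∪-right z z' y y' = trans (glue-∪ z z' ⊥ ⊥ y y') (cong (λ w → glue (z ∨ z') w (y ∪ y')) (∪-identityʳ ⊥))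

Empty-glue-∩ : ∀ z z' {x x' : Subset a} {y y' : Subset b} → z ∧ z' ≡ outside →
               Empty (x ∩ x') → Empty (y ∩ y') → Empty (glue z x y ∩ glue z' x' y')
Empty-glue-∩ z z' {x} {x'} {y} {y'} no-fresh ex ey
  rewrite glue-∩ z z' x x' y y' | no-fresh = Empty-outside (Empty-++ (x ∩ x') ex ey)

Nonempty-glue-∩ˡ : ∀ z z' {x x' : Subset a} {y y' : Subset b} →
                   Nonempty (x ∩ x') → Nonempty (glue z x y ∩ glue z' x' y')
Nonempty-glue-∩ˡ z z' {x} {x'} {y} {y'} ne
  rewrite glue-∩ z z' x x' y y' = Nonempty-∷ (z ∧ z') (Nonempty-++ˡ (x ∩ x') ne)

Nonempty-glue-∩ʳ : ∀ z z' {x x' : Subset a} {y y' : Subset b} →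
                   Nonempty (y ∩ y') → Nonempty (glue z x y ∩ glue z' x' y')
Nonempty-glue-∩ʳ z z' {x} {x'} {y} {y'} ne
  rewrite glue-∩ z z' x x' y y' = Nonempty-∷ (z ∧ z') (Nonempty-++ʳ (x ∩ x') ne)

Empty-⊥∩⊥ : Empty (⊥ {n} ∩ ⊥)
Empty-⊥∩⊥ = subst Empty (sym (∩-zeroˡ ⊥)) Empty-⊥

-- Set pairs over the ground set Fin n; systems are ordered lists of pairs.
Pair : ℕ → Set
Pair n = Subset n × Subset n

Admissible : ℕ → ℕ → Pair n → Set
Admissible k l (A , B) = ∣ A ∣ ≤ k × ∣ B ∣ ≤ l × Empty (A ∩ B)

Crosses : Pair n → Pair n → Set
Crosses (A , _) (_ , B) = Nonempty (A ∩ B)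

SkewList : ℕ → ℕ → List (Pair n) → Set
SkewList k l ps = All (Admissible k l) ps × AllPairs Crosses ps

covered : Pair n → Subset n
covered (A , B) = A ∪ B

Union : List (Pair n) → Subset n
Union ps = ⋃ (map covered ps)

Union-++ : (ps qs : List (Pair n)) → Union (ps ++ₗ qs) ≡ Union ps ∪ Union qs
Union-++ []       qs = sym (∪-identityˡ (Union qs))
Union-++ (p ∷ ps) qs = trans (cong (covered p ∪_) (Union-++ ps qs)) (sym (∪-assoc (covered p) (Union ps) (Union qs)))

Union-map : (f : Pair a → Pair b) (e : Subset a → Subset b) →
            (∀ s t → e s ∪ e t ≡ e (s ∪ t)) → (∀ p → covered (f p) ≡ e (covered p)) →
            ∀ p ps → Union (map f (p ∷ ps)) ≡ e (Union (p ∷ ps))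
Union-map f e e-∪ f-covered p [] = begin
  covered (f p) ∪ ⊥        ≡⟨ ∪-identityʳ (covered (f p)) ⟩
  covered (f p)            ≡⟨ f-covered p ⟩
  e (covered p)            ≡⟨ cong e (sym (∪-identityʳ (covered p))) ⟩
  e (covered p ∪ ⊥)        ∎
  where open ≡-Reasoning
Union-map f e e-∪ f-covered p (q ∷ qs) = begin
  covered (f p) ∪ Union (map f (q ∷ qs))  ≡⟨ cong₂ _∪_ (f-covered p) (Union-map f e e-∪ f-covered q qs) ⟩
  e (covered p) ∪ e (Union (q ∷ qs))      ≡⟨ e-∪ (covered p) (Union (q ∷ qs)) ⟩
  e (Union (p ∷ q ∷ qs))                  ∎
  where open ≡-Reasoning

SkewList-++ : {ps qs : List (Pair n)} → SkewList k l ps → SkewList k l qs →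
              All (λ p → All (Crosses p) qs) ps → SkewList k l (ps ++ₗ qs)
SkewList-++ (ps-adm , ps-cross) (qs-adm , qs-cross) between =
  All.++⁺ ps-adm qs-adm , AllPairs.++⁺ ps-cross qs-cross between

module Lift (a b : ℕ) where

  liftˡ : Pair a → Pair (suc (a + b))
  liftˡ (A , B) = glue inside A ⊥ , glue outside B ⊥

  liftʳ : Pair b → Pair (suc (a + b))
  liftʳ (A , B) = glue outside ⊥ A , glue inside ⊥ B

  admissible-liftˡ : (p : Pair a) → Admissible k l p → Admissible (suc k) l (liftˡ p)
  admissible-liftˡ {k = k} {l} (A , B) (∣A∣≤k , ∣B∣≤l , A∩B=∅) =
    s≤s (subst (_≤ k) (sym (∣++⊥∣ {b = b} A)) ∣A∣≤k) ,
    subst (_≤ l) (sym (∣++⊥∣ {b = b} B)) ∣B∣≤l ,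
    Empty-glue-∩ inside outside refl A∩B=∅ Empty-⊥∩⊥

  admissible-liftʳ : (p : Pair b) → Admissible k l p → Admissible k (suc l) (liftʳ p)
  admissible-liftʳ {k = k} {l} (A , B) (∣A∣≤k , ∣B∣≤l , A∩B=∅) =
    subst (_≤ k) (sym (∣⊥++∣ {a = a} A)) ∣A∣≤k ,
    s≤s (subst (_≤ l) (sym (∣⊥++∣ {a = a} B)) ∣B∣≤l) ,
    Empty-glue-∩ outside inside refl Empty-⊥∩⊥ A∩B=∅

  crosses-liftˡ : (p q : Pair a) → Crosses p q → Crosses (liftˡ p) (liftˡ q)
  crosses-liftˡ (A , _) (_ , B) = Nonempty-glue-∩ˡ inside outside

  crosses-liftʳ : (p q : Pair b) → Crosses p q → Crosses (liftʳ p) (liftʳ q)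
  crosses-liftʳ (A , _) (_ , B) = Nonempty-glue-∩ʳ outside inside

  crosses-liftˡʳ : (p : Pair a) (q : Pair b) → Crosses (liftˡ p) (liftʳ q)
  crosses-liftˡʳ _ _ = zero , here

  SkewList-liftˡ : {ps : List (Pair a)} → SkewList k l ps → SkewList (suc k) l (map liftˡ ps)
  SkewList-liftˡ (adm , cross) =
    All.map⁺ (All.map (λ {p} → admissible-liftˡ p) adm) ,
    AllPairs.map⁺ (AllPairs.map (λ {p} {q} → crosses-liftˡ p q) cross)

  SkewList-liftʳ : {ps : List (Pair b)} → SkewList k l ps → SkewList k (suc l) (map liftʳ ps)
  SkewList-liftʳ (adm , cross) =
    All.map⁺ (All.map (λ {p} → admissible-liftʳ p) adm) ,
    AllPairs.map⁺ (AllPairs.map (λ {p} {q} → crosses-liftʳ p q) cross)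

  crosses-all : (ps : List (Pair a)) (qs : List (Pair b)) →
                All (λ p → All (Crosses p) (map liftʳ qs)) (map liftˡ ps)
  crosses-all ps qs = All.map⁺ (All.tabulate λ {p} _ → All.map⁺ (All.tabulate λ {q} _ → crosses-liftˡʳ p q))

  Union-liftˡ : ∀ p ps → Union (map liftˡ (p ∷ ps)) ≡ glue inside (Union (p ∷ ps)) ⊥
  Union-liftˡ = Union-map liftˡ (λ s → glue inside s ⊥) (λ s t → glue-∪-left {b = b} inside inside s t)
                  (λ { (A , B) → glue-∪-left {b = b} inside outside A B })

  Union-liftʳ : ∀ p ps → Union (map liftʳ (p ∷ ps)) ≡ glue inside ⊥ (Union (p ∷ ps))
  Union-liftʳ = Union-map liftʳ (λ s → glue inside ⊥ s) (λ s t → glue-∪-right {a = a} inside inside s t)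
                  (λ { (A , B) → glue-∪-right {a = a} outside inside A B })

record System (k l : ℕ) : Set where
  field
    ground : ℕ
    first  : Pair ground
    rest   : List (Pair ground)
    skew   : SkewList k l (first ∷ rest)

  pairs : List (Pair ground)
  pairs = first ∷ rest

open System

single : (A B : Subset n) → ∣ A ∣ ≤ k → ∣ B ∣ ≤ l → Empty (A ∩ B) → System k l
single {n = n} A B ∣A∣≤k ∣B∣≤l A∩B=∅ = record
  { ground = n ; first = A , B ; rest = []
  ; skew   = (∣A∣≤k , ∣B∣≤l , A∩B=∅) ∷ [] , [] ∷ [] }

merge : System k (suc l) → System (suc k) l → System (suc k) (suc l)
merge S T = record
  { ground = suc (ground S + ground T)
  ; first  = liftˡ (first S)
  ; rest   = map liftˡ (rest S) ++ₗ map liftʳ (pairs T)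
  ; skew   = SkewList-++ (SkewList-liftˡ (skew S)) (SkewList-liftʳ (skew T)) (crosses-all (pairs S) (pairs T)) }
  where open Lift (ground S) (ground T)

∣Union-merge∣ : (S : System k (suc l)) (T : System (suc k) l) →
                ∣ Union (pairs (merge S T)) ∣ ≡ suc (∣ Union (pairs S) ∣ + ∣ Union (pairs T) ∣)
∣Union-merge∣ S T = begin
  ∣ Union (map liftˡ (pairs S) ++ₗ map liftʳ (pairs T)) ∣
    ≡⟨ cong ∣_∣ (Union-++ (map liftˡ (pairs S)) (map liftʳ (pairs T))) ⟩
  ∣ Union (map liftˡ (pairs S)) ∪ Union (map liftʳ (pairs T)) ∣
    ≡⟨ cong ∣_∣ (cong₂ _∪_ (Union-liftˡ (first S) (rest S)) (Union-liftʳ (first T) (rest T))) ⟩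
  ∣ glue inside US ⊥ ∪ glue inside ⊥ UT ∣
    ≡⟨ cong ∣_∣ (glue-∪ inside inside US ⊥ ⊥ UT) ⟩
  ∣ glue inside (US ∪ ⊥) (⊥ ∪ UT) ∣
    ≡⟨ cong₂ (λ x y → ∣ glue inside x y ∣) (∪-identityʳ US) (∪-identityˡ UT) ⟩
  suc ∣ US ++ UT ∣
    ≡⟨ cong suc (∣++∣ US UT) ⟩
  suc (∣ US ∣ + ∣ UT ∣) ∎
  where
    open Lift (ground S) (ground T)
    open ≡-Reasoning
    US = Union (pairs S)
    UT = Union (pairs T)

construction : ∀ k l → System k l
construction zero    l       = single (⊥ {l}) ⊤ (≤-reflexive (∣⊥∣≡0 l)) (≤-reflexive (∣⊤∣≡n l))
                                 (subst Empty (sym (∩-zeroˡ ⊤)) Empty-⊥)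
construction (suc k) zero    = single (⊤ {suc k}) ⊥ (≤-reflexive (∣⊤∣≡n (suc k))) (≤-reflexive (∣⊥∣≡0 (suc k)))
                                 (subst Empty (sym (∩-zeroʳ ⊤)) Empty-⊥)
construction (suc k) (suc l) = merge (construction k (suc l)) (construction (suc k) l)

unionSize : ℕ → ℕ → ℕ
unionSize zero    l       = l
unionSize (suc k) zero    = suc k
unionSize (suc k) (suc l) = suc (unionSize k (suc l) + unionSize (suc k) l)

∣Union-construction∣ : ∀ k l → ∣ Union (pairs (construction k l)) ∣ ≡ unionSize k l
∣Union-construction∣ zero l = begin
  ∣ (⊥ {l} ∪ ⊤) ∪ ⊥ ∣  ≡⟨ cong (∣_∣ {n = l}) (trans (∪-identityʳ (⊥ ∪ ⊤)) (∪-identityˡ ⊤)) ⟩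
  ∣ ⊤ {l} ∣            ≡⟨ ∣⊤∣≡n l ⟩
  l                    ∎
  where open ≡-Reasoning
∣Union-construction∣ (suc k) zero = begin
  ∣ (⊤ {suc k} ∪ ⊥) ∪ ⊥ ∣  ≡⟨ cong (∣_∣ {n = suc k}) (trans (∪-identityʳ (⊤ ∪ ⊥)) (∪-identityʳ ⊤)) ⟩
  ∣ ⊤ {suc k} ∣            ≡⟨ ∣⊤∣≡n (suc k) ⟩
  suc k                    ∎
  where open ≡-Reasoning
∣Union-construction∣ (suc k) (suc l) =
  trans (∣Union-merge∣ (construction k (suc l)) (construction (suc k) l))
        (cong suc (cong₂ _+_ (∣Union-construction∣ k (suc l)) (∣Union-construction∣ (suc k) l)))

-- The binomial lower bound on unionSize, by induction along its recursion
-- using Pascal's rule C(n, j) + C(n, j+1) = C(n+1, j+1).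
unionSize-bound : ∀ k l → suc k + l + (suc k + l) C suc (suc k) ≤ unionSize (suc k) l
unionSize-bound k zero = begin
  suc k + 0 + (suc k + 0) C suc (suc k)  ≡⟨ cong (λ n → n + n C suc (suc k)) (+-identityʳ (suc k)) ⟩
  suc k + suc k C suc (suc k)            ≡⟨ cong (suc k +_) (k>n⇒nCk≡0 (n<1+n (suc k))) ⟩
  suc k + 0                              ≡⟨ +-identityʳ (suc k) ⟩
  suc k                                  ∎
  where open ≤-Reasoning
unionSize-bound zero (suc l) = begin
  suc (suc l + suc (suc l) C 2)          ≡⟨ cong (λ c → suc (suc l + c)) pascal ⟩
  suc (suc l + (suc l + suc l C 2))      ≤⟨ s≤s (+-monoʳ-≤ (suc l) (unionSize-bound zero l)) ⟩
  suc (suc l + unionSize 1 l)            ∎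
  where
    open ≤-Reasoning
    pascal : suc (suc l) C 2 ≡ suc l + suc l C 2
    pascal = trans (sym (nCk+nC[k+1]≡[n+1]C[k+1] (suc l) 1)) (cong (_+ suc l C 2) (nC1≡n (suc l)))
unionSize-bound (suc k) (suc l) = begin
  suc (kl + suc kl C suc (suc (suc k)))                ≡⟨ cong (λ c → suc (kl + c)) (sym (nCk+nC[k+1]≡[n+1]C[k+1] kl (suc (suc k)))) ⟩
  suc (kl + (kl C suc (suc k) + kl C suc (suc (suc k)))) ≡⟨ cong suc (sym (+-assoc kl _ _)) ⟩
  suc (kl + kl C suc (suc k) + kl C suc (suc (suc k)))  ≤⟨ s≤s (+-mono-≤ (unionSize-bound k (suc l)) right) ⟩
  suc (unionSize (suc k) (suc l) + unionSize (suc (suc k)) l) ∎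
  where
    open ≤-Reasoning
    kl = suc k + suc l
    right : kl C suc (suc (suc k)) ≤ unionSize (suc (suc k)) l
    right = ≤-trans (m≤n+m _ kl)
      (subst (λ m → m + m C suc (suc (suc k)) ≤ unionSize (suc (suc k)) l) (sym (+-suc (suc k) l))
             (unionSize-bound (suc k) l))

AllPairs-lookup : ∀ {A : Set} {R : A → A → Set} {xs : List A} → AllPairs R xs →
                  ∀ {i j} → i < j → R (lookup xs i) (lookup xs j)
AllPairs-lookup (Rx ∷ _)   {zero}  {suc j} _         = All.lookup Rx (∈-lookup j)
AllPairs-lookup (_ ∷ Rxs)  {suc i} {suc j} (s≤s i<j) = AllPairs-lookup Rxs i<j

SkewList⇒SkewCrossIntersecting : {ps : List (Pair n)} → SkewList k l ps →
  SkewCrossIntersecting k l n (length ps) (λ i → proj₁ (lookup ps i)) (λ i → proj₂ (lookup ps i))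
SkewList⇒SkewCrossIntersecting {ps = ps} (adm , cross) = record
  { sizeA    = λ i → proj₁ (admissible i)
  ; sizeB    = λ i → proj₁ (proj₂ (admissible i))
  ; disjoint = λ i → proj₂ (proj₂ (admissible i))
  ; cross    = λ i j → AllPairs-lookup cross }
  where
    admissible : ∀ i → Admissible _ _ (lookup ps i)
    admissible i = All.lookup adm (∈-lookup i)

unionPairs-lookup : (ps : List (Pair n)) →
  unionPairs (λ i → proj₁ (lookup ps i)) (λ i → proj₂ (lookup ps i)) ≡ Union ps
unionPairs-lookup ps = begin
  ⋃ (map (λ i → covered (lookup ps i)) (allFin (length ps)))  ≡⟨ cong ⋃ (map-tabulate (λ i → i) (λ i → covered (lookup ps i))) ⟩
  ⋃ (tabulate (λ i → covered (lookup ps i)))                 ≡⟨ cong ⋃ (sym (map-tabulate (lookup ps) covered)) ⟩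
  ⋃ (map covered (tabulate (lookup ps)))                     ≡⟨ cong (λ qs → ⋃ (map covered qs)) (tabulate-lookup ps) ⟩
  Union ps                                                   ∎
  where open ≡-Reasoning

mainTheorem7 : (k l : ℕ) → 1 ≤ k → 1 ≤ l →
    Σ ℕ (λ N → Σ ℕ (λ m → Σ (Fin m → Subset N) (λ A → Σ (Fin m → Subset N) (λ B →
    SkewCrossIntersecting k l N m A B × (k + l + ((k + l) C (suc k)) ≤ ∣ unionPairs A B ∣)))))
mainTheorem7 (suc k) l _ _ =
  ground S , length (pairs S) , A , B , SkewList⇒SkewCrossIntersecting (skew S) , (begin
    suc k + l + (suc k + l) C suc (suc k)  ≤⟨ unionSize-bound k l ⟩
    unionSize (suc k) l                    ≡⟨ sym (∣Union-construction∣ (suc k) l) ⟩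
    ∣ Union (pairs S) ∣                    ≡⟨ cong ∣_∣ (sym (unionPairs-lookup (pairs S))) ⟩
    ∣ unionPairs A B ∣                     ∎)
  where
    open ≤-Reasoning
    S = construction (suc k) l
    A B : Fin (length (pairs S)) → Subset (ground S)
    A i = proj₁ (lookup (pairs S) i)
    B i = proj₂ (lookup (pairs S) i)
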